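{- For all integers $j \ge 0$ and $n \ge 1$ such that $S_j(n)$ is nonempty, \[ s_j(n) - 1 \le \max S_j(n) \le \frac{n}{j+2}. \]
   Context: $n \bmod k$ denotes the least nonnegative remainder of $n$ upon division by $k$. Define $S_0(n) := \{1,2,\ldots,\lfloor n/2\rfloor\}$ and $S_j(n) := \{ n \bmod k : k \in S_{j-1}(n)\setminus\{0\}\}$ for $j\ge1$, and $s_j(n) := |S_j(n)|$. -}

module Defs where

open import Data.Nat using (ℕ; zero; suc; _⊔_; _≟_; NonZero)
open import Data.Nat.DivMod using (_%_)
open import Data.List using (List; []; _∷_; map; filter; foldr; length; deduplicate; applyUpTo)
open import Relation.Nullary using (¬_)
open import Relation.Nullary.Decidable using (¬?)
open import Data.Nat using (_/_)

modNZ : ℕ → ℕ → ℕ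
modNZ n zero    = zero   -- never used: zero is filtered out before
modNZ n (suc k) = n % suc k

-- S j n as a list (possibly with repetitions); the set S_j(n) is the
-- set of members of this list.
-- S_0(n) = {1, ..., ⌊n/2⌋}
-- S_j(n) = { n mod k : k ∈ S_{j-1}(n), k ≠ 0 }
S : ℕ → ℕ → List ℕ
S zero    n = applyUpTo suc (n / 2)
S (suc j) n = map (modNZ n) (filter (λ k → ¬? (k ≟ 0)) (S j n))

s : ℕ → ℕ → ℕ
s j n = length (deduplicate _≟_ (S j n))

maxL : List ℕ → ℕ
maxL = foldr _⊔_ 0

{-# OPTIONS --safe #-}
module Submission where

-- Each element of S_{j+1}(n) is a remainder r = n mod k of some nonzero k ∈ S_j(n).
-- If c k ≤ n then n = q k + r with q ≥ c and r < k, so (c + 1) r = r + c r ≤ r + q k = n.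
-- As 2 m ≤ n on S_0(n), induction on j gives (j + 2) m ≤ n for every m ∈ S_j(n).
-- The other inequality is pigeonhole: the s_j(n) distinct elements of S_j(n) lie in {0, …, max S_j(n)}.

open import Defs
open import Data.Nat using (ℕ; suc; zero; _≤_; _<_; _∸_; _*_; _+_; _⊔_; _≟_; z≤n; s≤s; _/_; _%_; NonZero)
open import Data.Nat.Properties
open import Data.Nat.DivMod using (m≡m%n+[m/n]*n; m%n<n; m*n/n≡m; /-monoˡ-≤; m/n*n≤m)
open import Data.Fin using (Fin; zero; suc; fromℕ<)
open import Data.Fin.Properties using (injective⇒≤; fromℕ<-injective)
open import Data.List using (List; []; _∷_; length; lookup; deduplicate)
open import Data.List.Properties using (foldr-preservesᵇ)
open import Data.List.Membership.Propositional.Properties using (∈-lookup)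
open import Data.List.Relation.Unary.All as All using (All; []; _∷_)
open import Data.List.Relation.Unary.All.Properties using (map⁺; applyUpTo⁺₁; all-filter; filter⁺; deduplicate⁺)
open import Data.List.Relation.Unary.AllPairs using (_∷_)
open import Data.List.Relation.Unary.Unique.Propositional using (Unique)
open import Data.List.Relation.Unary.Unique.DecPropositional.Properties _≟_ using (deduplicate-!)
open import Data.Product using (_×_; _,_; uncurry)
open import Function.Definitions using (Injective)
open import Level using (Level)
open import Relation.Binary.PropositionalEquality using (_≡_; _≢_; refl; sym; cong; subst)
open import Relation.Nullary using (contradiction)
open import Relation.Nullary.Decidable using (¬?)
open import Relation.Unary using (Decidable)

private variable
  a : Level
  A : Set a

Unique⇒lookup-injective : {xs : List A} → Unique xs → Injective _≡_ _≡_ (lookup xs)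
Unique⇒lookup-injective {xs = _ ∷ _} _            {zero}  {zero}  _  = refl
Unique⇒lookup-injective              (x∉xs ∷ _)   {zero}  {suc j} eq = contradiction eq (All.lookup x∉xs (∈-lookup j))
Unique⇒lookup-injective              (x∉xs ∷ _)   {suc i} {zero}  eq = contradiction (sym eq) (All.lookup x∉xs (∈-lookup i))
Unique⇒lookup-injective              (_ ∷ unique) {suc i} {suc j} eq = cong suc (Unique⇒lookup-injective unique eq)

Unique∧All<⇒length≤ : ∀ {b} {xs : List ℕ} → Unique xs → All (_< b) xs → length xs ≤ b
Unique∧All<⇒length≤ {b} {xs} unique xs<b =
  injective⇒≤ {f = toFin} λ {i} {j} eq →
    Unique⇒lookup-injective unique (fromℕ<-injective (lookup xs i) (lookup xs j) (bound i) (bound j) eq)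
  where
  bound : ∀ i → lookup xs i < b
  bound i = All.lookup xs<b (∈-lookup i)
  toFin : Fin (length xs) → Fin b
  toFin i = fromℕ< (bound i)

xs≤maxL : ∀ xs → All (_≤ maxL xs) xs
xs≤maxL []       = []
xs≤maxL (x ∷ xs) = m≤m⊔n x (maxL xs) ∷ All.map (λ y≤ → ≤-trans y≤ (m≤n⊔m x (maxL xs))) (xs≤maxL xs)

*-maxL≤ : ∀ c {n} xs → All (λ m → c * m ≤ n) xs → c * maxL xs ≤ n
*-maxL≤ c {n} xs = foldr-preservesᵇ {P = λ m → c * m ≤ n} ⊔-pres (subst (_≤ n) (sym (*-zeroʳ c)) z≤n)
  where
  ⊔-pres : ∀ {x y} → c * x ≤ n → c * y ≤ n → c * (x ⊔ y) ≤ n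
  ⊔-pres {x} {y} cx≤n cy≤n = subst (_≤ n) (sym (*-distribˡ-⊔ c x y)) (⊔-lub cx≤n cy≤n)

length-deduplicate∸1≤maxL : ∀ xs → length (deduplicate _≟_ xs) ∸ 1 ≤ maxL xs
length-deduplicate∸1≤maxL xs =
  ∸-monoˡ-≤ 1 (Unique∧All<⇒length≤ (deduplicate-! xs) (deduplicate⁺ _≟_ (All.map s≤s (xs≤maxL xs))))

m≤n/o⇒m*o≤n : ∀ {m n o} .{{_ : NonZero o}} → m ≤ n / o → m * o ≤ n
m≤n/o⇒m*o≤n {n = n} {o} m≤n/o = ≤-trans (*-monoˡ-≤ o m≤n/o) (m/n*n≤m n o)

m*o≤n⇒m≤n/o : ∀ {m n o} .{{_ : NonZero o}} → m * o ≤ n → m ≤ n / o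
m*o≤n⇒m≤n/o {m} {n} {o} m*o≤n = subst (_≤ n / o) (m*n/n≡m m o) (/-monoˡ-≤ o m*o≤n)

c*k≤n⇒[1+c]*[n%k]≤n : ∀ {c n} k .{{_ : NonZero k}} → c * k ≤ n → suc c * (n % k) ≤ n
c*k≤n⇒[1+c]*[n%k]≤n {c} {n} k c*k≤n = begin
  n % k + c * (n % k) ≤⟨ +-monoʳ-≤ (n % k) (*-monoʳ-≤ c (<⇒≤ (m%n<n n k))) ⟩
  n % k + c * k       ≤⟨ +-monoʳ-≤ (n % k) (*-monoˡ-≤ k (m*o≤n⇒m≤n/o {c} {n} {k} c*k≤n)) ⟩
  n % k + n / k * k   ≡⟨ m≡m%n+[m/n]*n n k ⟨
  n                   ∎
  where open ≤-Reasoning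

modNZ-bound : ∀ {c n k} → k ≢ 0 → c * k ≤ n → suc c * modNZ n k ≤ n
modNZ-bound     {k = zero}  k≢0 _     = contradiction refl k≢0
modNZ-bound {c} {k = suc k} _   c*k≤n = c*k≤n⇒[1+c]*[n%k]≤n {c} (suc k) c*k≤n

S-bound : ∀ j n → All (λ m → (j + 2) * m ≤ n) (S j n)
S-bound zero    n = applyUpTo⁺₁ suc (n / 2) λ {i} i<n/2 →
  subst (_≤ n) (*-comm (suc i) 2) (m≤n/o⇒m*o≤n i<n/2)
S-bound (suc j) n =
  map⁺ (All.map (uncurry (modNZ-bound {j + 2} {n}))
              (All.zip (all-filter nonzero? (S j n) , filter⁺ nonzero? (S-bound j n))))
  where
  nonzero? : Decidable (_≢ 0)
  nonzero? k = ¬? (k ≟ 0)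

lemma6p1 : (j n : ℕ) → 1 ≤ n → S j n ≢ [] →
    (s j n ∸ 1 ≤ maxL (S j n)) × ((j + 2) * maxL (S j n) ≤ n)
lemma6p1 j n _ _ = length-deduplicate∸1≤maxL (S j n) , *-maxL≤ (j + 2) (S j n) (S-bound j n)
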